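{- Let $q\geq 3$ be an integer, $B\in(0,1)$, and set $\chi=\frac{1+B}{B+q-1}$. Let $P$ be a path with $\ell\geq 2$ vertices and endpoints $u,v$, and let $\mu_P$ be the Potts distribution on $P$ with parameter $B$. Then for arbitrary colours $c,c'\in[q]$, \[\mu_P(P\text{ is bichromatic}\mid\sigma_u=c,\sigma_v=c')\leq (4q/B)\chi^{\ell-2}.\]
   Context: Potts distribution: $\mu_G(\sigma)=B^{m(\sigma)}/Z_G$ for $\sigma:V\to[q]$, with $m(\sigma)$ the number of monochromatic edges. A path is bichromatic under $\sigma$ if there exist colours $c_1,c_2\in[q]$ such that every vertex of the path has colour in $\{c_1,c_2\}$.
   Formalization: The parameter B ranges over the rational numbers in (0,1). -}

module Defs where

open import Data.Nat as ℕ using (ℕ; zero; suc; _∸_)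
open import Data.Integer using (+_)
open import Data.Rational as ℚ using (ℚ; 0ℚ; 1ℚ; _+_; _*_; _÷_; _/_; _<_; Positive; NonNegative)
open import Data.Rational.Properties as ℚP using (+-mono-<-≤; normalize-nonNeg; nonNegative⁻¹; pos⇒nonZero)
open import Data.Bool using (true; false; if_then_else_)
open import Data.Empty using (⊥)
open import Relation.Nullary using (no)
open import Data.Fin using (Fin; _≟_)
open import Data.Fin.Properties using (any?)
open import Data.Vec as Vec using (Vec; []; _∷_; head; last)
open import Data.Vec.Relation.Unary.All using (All; all?)
open import Data.List as List using (List; []; _∷_; concatMap; allFin; map; filter)
open import Data.Product using (∃; ∃-syntax; _,_)
open import Data.Sum using (_⊎_)
open import Relation.Binary.PropositionalEquality using (_≡_)
open import Relation.Nullary using (Dec; does)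
open import Relation.Nullary.Decidable using (_⊎-dec_; _×-dec_)
open import Relation.Unary using (Decidable)

ℕ→ℚ : ℕ → ℚ
ℕ→ℚ n = + n / 1

infixr 8 _^ℚ_
_^ℚ_ : ℚ → ℕ → ℚ
x ^ℚ zero  = 1ℚ
x ^ℚ suc n = x * (x ^ℚ n)

sumℚ : List ℚ → ℚ
sumℚ = List.foldr _+_ 0ℚ

-- A colouring of the path P_ℓ (vertices 0,…,ℓ-1, edges {i,i+1})
-- is a vector σ of length ℓ of colours in [q] = Fin q.
Colouring : ℕ → ℕ → Set
Colouring q ℓ = Vec (Fin q) ℓ

allColourings : (q ℓ : ℕ) → List (Colouring q ℓ)
allColourings q zero    = [] ∷ []
allColourings q (suc ℓ) =
  concatMap (λ c → map (c ∷_) (allColourings q ℓ)) (allFin q)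

mono : ∀ {q ℓ} → Colouring q ℓ → ℕ
mono []           = 0
mono (x ∷ [])     = 0
mono (x ∷ y ∷ xs) = (if does (x ≟ y) then 1 else 0) ℕ.+ mono (y ∷ xs)

weight : ∀ {q ℓ} → ℚ → Colouring q ℓ → ℚ
weight B σ = B ^ℚ mono σ

Bichromatic : ∀ {q ℓ} → Colouring q ℓ → Set
Bichromatic {q} σ = ∃[ c₁ ] ∃[ c₂ ] All (λ x → x ≡ c₁ ⊎ x ≡ c₂) σ

bichromatic? : ∀ {q ℓ} → Decidable (Bichromatic {q} {ℓ})
bichromatic? σ = any? λ c₁ → any? λ c₂ → all? (λ x → (x ≟ c₁) ⊎-dec (x ≟ c₂)) σ

-- Endpoint condition σ_u = c, σ_v = c' (u = first vertex, v = last vertex)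
-- (the empty path has no endpoints; irrelevant since ℓ ≥ 2 below)
EndCond : ∀ {q ℓ} → Fin q → Fin q → Colouring q ℓ → Set
EndCond c c' []       = ⊥
EndCond c c' (x ∷ xs) = x ≡ c Data.Product.× last (x ∷ xs) ≡ c'

endCond? : ∀ {q ℓ} (c c' : Fin q) → Decidable (EndCond {q} {ℓ} c c')
endCond? c c' []       = no λ ()
endCond? c c' (x ∷ xs) = (x ≟ c) ×-dec (last (x ∷ xs) ≟ c')

-- Z_G · μ(E ∩ {σ_u=c, σ_v=c'}) and Z_G · μ(σ_u=c, σ_v=c')
-- (sums of Potts weights over the corresponding sets of colourings)
Zend : (q ℓ : ℕ) → ℚ → Fin q → Fin q → ℚ
Zend q ℓ B c c' =
  sumℚ (map (weight B) (filter (endCond? c c') (allColourings q ℓ)))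

ZendBich : (q ℓ : ℕ) → ℚ → Fin q → Fin q → ℚ
ZendBich q ℓ B c c' =
  sumℚ (map (weight B) (filter (λ σ → endCond? c c' σ ×-dec bichromatic? σ)
                               (allColourings q ℓ)))

denom-pos : (q : ℕ) (B : ℚ) → 0ℚ < B → 0ℚ < B + ℕ→ℚ (q ∸ 1)
denom-pos q B 0<B =
  +-mono-<-≤ {0ℚ} {B} {0ℚ} {ℕ→ℚ (q ∸ 1)} 0<B (nonNegative⁻¹ (ℕ→ℚ (q ∸ 1)) {{normalize-nonNeg (q ∸ 1) 1}})

χ : (q : ℕ) (B : ℚ) → 0ℚ < B → ℚ
χ q B 0<B = ((1ℚ + B) ÷ (B + ℕ→ℚ (q ∸ 1)))
  {{pos⇒nonZero (B + ℕ→ℚ (q ∸ 1)) {{ℚ.positive {B + ℕ→ℚ (q ∸ 1)} (denom-pos q B 0<B)}}}}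

fourqOverB : (q : ℕ) (B : ℚ) → 0ℚ < B → ℚ
fourqOverB q B 0<B = (ℕ→ℚ (4 ℕ.* q) ÷ B) {{pos⇒nonZero B {{ℚ.positive {B} 0<B}}}}

module Submission where

-- Write ℓ = k + 2, D = 1 + B and L = B + (q - 1), so that χ = D / L.  The
-- weight B^{m(σ)} of a colouring of a path factorises into edge factors
-- e(x,y), equal to B if x = y and to 1 otherwise; for 0 ≤ B ≤ 1 we have
-- B ≤ e(x,y) ≤ 1.
--
-- Summing out the first vertex multiplies by Σ_x e(x,y) = L, so
-- the total weight of the colourings of a path with k + 1 vertices whose last
-- colour is prescribed is exactly L^k.  Prescribing also the first colour of
-- a path with k + 2 vertices loses at most the factor B of one edge, hence
-- Z(σ_u = c, σ_v = c') ≥ B·L^k.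
--
-- A bichromatic colouring starting with c only uses colours in
-- {c, b} for some b.  With two colours each further vertex contributes a
-- factor e(x,a) + e(x,b) ≤ D, so every b contributes at most D^{k+1} and
-- Z(bichromatic, σ_u = c, σ_v = c') ≤ q·D^{k+1}.
--
-- Finally q·D ≤ 4q and (4q/B)·χ^k·(B·L^k) = 4q·D^k, which gives the theorem.

open import Defs
open import Data.Nat using (ℕ; _≤_; _∸_)
open import Data.Fin using (Fin)
open import Data.Rational using (ℚ; 0ℚ; 1ℚ; _<_; _*_) renaming (_≤_ to _≤ℚ_)

open import Data.Nat as ℕ using (zero; suc; s≤s)
import Data.Nat.Properties as ℕP
import Data.Integer as ℤ
open import Data.Rational using (mkℚ; _+_; _÷_; 1/_; NonZero; Positive; nonNegative; positive)
import Data.Rational.Properties as QP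
import Data.Rational.Unnormalised as U
import Data.Rational.Unnormalised.Properties as UP
open import Data.Nat.Coprimality using (1-coprimeTo) renaming (sym to coprime-sym)
open import Data.Fin using (zero; suc; _≟_)
open import Data.Vec using (_∷_; head; last)
open import Data.Vec.Relation.Unary.All using (All; _∷_; all?) renaming (map to All-map)
open import Data.List using (List; []; _∷_; _++_; map; concatMap; filter; allFin)
import Data.List.Properties as LP
open import Data.Bool using (Bool; true; false; T; _∧_; _∨_; if_then_else_)
open import Data.Unit using (tt)
open import Data.Product using (_,_)
open import Data.Sum using (_⊎_; inj₁; inj₂; swap)
open import Data.Empty using (⊥-elim)
open import Relation.Nullary using (Dec; does; yes; no; ¬_)
open import Relation.Nullary.Decidable using (_×-dec_; _⊎-dec_; dec-true)
open import Relation.Unary using (Pred; Decidable)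
open import Relation.Binary.PropositionalEquality
open import Function using (id; _∘_)
open import Algebra.Bundles using (CommutativeMonoid)
open import Algebra.Properties.CommutativeSemigroup (CommutativeMonoid.commutativeSemigroup QP.*-1-commutativeMonoid) using () renaming (interchange to *-interchange)
open import Algebra.Properties.CommutativeSemigroup (CommutativeMonoid.commutativeSemigroup QP.+-0-commutativeMonoid) using () renaming (interchange to +-interchange)

-- Order facts for rationals, stated with hypotheses 0 ≤ p rather than with
-- the NonNegative instances the library uses.

+-nonneg : ∀ {p r} → 0ℚ ≤ℚ p → 0ℚ ≤ℚ r → 0ℚ ≤ℚ p + r
+-nonneg {p} {r} 0≤p 0≤r = subst (_≤ℚ p + r) (QP.+-identityˡ 0ℚ) (QP.+-mono-≤ 0≤p 0≤r)

*-nonneg : ∀ {p r} → 0ℚ ≤ℚ p → 0ℚ ≤ℚ r → 0ℚ ≤ℚ p * r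
*-nonneg {p} {r} 0≤p 0≤r =
  QP.nonNegative⁻¹ (p * r) {{QP.nonNeg*nonNeg⇒nonNeg p {{nonNegative 0≤p}} r {{nonNegative 0≤r}}}}

*-monoˡ-nonneg : ∀ r {p s} → 0ℚ ≤ℚ r → p ≤ℚ s → r * p ≤ℚ r * s
*-monoˡ-nonneg r 0≤r = QP.*-monoˡ-≤-nonNeg r {{nonNegative 0≤r}}

*-monoʳ-nonneg : ∀ r {p s} → 0ℚ ≤ℚ r → p ≤ℚ s → p * r ≤ℚ s * r
*-monoʳ-nonneg r 0≤r = QP.*-monoʳ-≤-nonNeg r {{nonNegative 0≤r}}

^-nonneg : ∀ {a} k → 0ℚ ≤ℚ a → 0ℚ ≤ℚ a ^ℚ k
^-nonneg zero    0≤a = QP.nonNegative⁻¹ 1ℚ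
^-nonneg (suc k) 0≤a = *-nonneg 0≤a (^-nonneg k 0≤a)

≤-+ʳ : ∀ p {r} → 0ℚ ≤ℚ r → p ≤ℚ p + r
≤-+ʳ p {r} 0≤r = subst (_≤ℚ p + r) (QP.+-identityʳ p) (QP.+-monoʳ-≤ p 0≤r)

^-distrib-* : ∀ a b k → (a * b) ^ℚ k ≡ a ^ℚ k * b ^ℚ k
^-distrib-* a b zero    = refl
^-distrib-* a b (suc k) = begin
  (a * b) * (a * b) ^ℚ k        ≡⟨ cong ((a * b) *_) (^-distrib-* a b k) ⟩
  (a * b) * (a ^ℚ k * b ^ℚ k)   ≡⟨ *-interchange a b (a ^ℚ k) (b ^ℚ k) ⟩
  (a * a ^ℚ k) * (b * b ^ℚ k)   ∎
  where open ≡-Reasoning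

-- The embedding ℕ → ℚ is additive and non-negative; ℕ→ℚ n is the rational
-- n/1 in lowest terms, and additivity is checked on unnormalised rationals.
ℕ→ℚ-suc : ∀ n → ℕ→ℚ (suc n) ≡ 1ℚ + ℕ→ℚ n
ℕ→ℚ-suc zero      = refl
ℕ→ℚ-suc n@(suc m) =
  QP.toℚᵘ-injective (UP.≃-trans unnormalised (UP.≃-sym (QP.toℚᵘ-homo-+ 1ℚ (ℕ→ℚ n))))
  where
  n/1 : ∀ n → ℕ→ℚ n ≡ mkℚ (ℤ.+ n) 0 (coprime-sym (1-coprimeTo n))
  n/1 n = QP.normalize-coprime (coprime-sym (1-coprimeTo n))

  unnormalised : Data.Rational.toℚᵘ (ℕ→ℚ (suc n)) U.≃ (Data.Rational.toℚᵘ 1ℚ U.+ Data.Rational.toℚᵘ (ℕ→ℚ n))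
  unnormalised rewrite n/1 (suc n) | n/1 n =
    U.*≡* (cong (λ k → ℤ.+ suc (suc k)) (sym (ℕP.*-identityʳ (m ℕ.* 1))))

ℕ→ℚ-+ : ∀ m n → ℕ→ℚ (m ℕ.+ n) ≡ ℕ→ℚ m + ℕ→ℚ n
ℕ→ℚ-+ zero    n = sym (QP.+-identityˡ _)
ℕ→ℚ-+ (suc m) n = begin
  ℕ→ℚ (suc (m ℕ.+ n))      ≡⟨ ℕ→ℚ-suc (m ℕ.+ n) ⟩
  1ℚ + ℕ→ℚ (m ℕ.+ n)       ≡⟨ cong (1ℚ +_) (ℕ→ℚ-+ m n) ⟩
  1ℚ + (ℕ→ℚ m + ℕ→ℚ n)     ≡⟨ sym (QP.+-assoc 1ℚ (ℕ→ℚ m) (ℕ→ℚ n)) ⟩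
  (1ℚ + ℕ→ℚ m) + ℕ→ℚ n     ≡⟨ cong (_+ ℕ→ℚ n) (sym (ℕ→ℚ-suc m)) ⟩
  ℕ→ℚ (suc m) + ℕ→ℚ n      ∎
  where open ≡-Reasoning

ℕ→ℚ-nonneg : ∀ n → 0ℚ ≤ℚ ℕ→ℚ n
ℕ→ℚ-nonneg n = QP.nonNegative⁻¹ (ℕ→ℚ n) {{QP.normalize-nonNeg n 1}}

∑ : {A : Set} → List A → (A → ℚ) → ℚ
∑ xs f = sumℚ (map f xs)

syntax ∑ xs (λ x → e) = ∑[ x ∈ xs ] e

∑-++ : ∀ {A : Set} xs ys (f : A → ℚ) → ∑ (xs ++ ys) f ≡ ∑ xs f + ∑ ys f
∑-++ []       ys f = sym (QP.+-identityˡ _)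
∑-++ (x ∷ xs) ys f = trans (cong (f x +_) (∑-++ xs ys f)) (sym (QP.+-assoc (f x) _ _))

∑-concatMap : ∀ {A B : Set} (g : A → List B) xs (f : B → ℚ) →
  ∑ (concatMap g xs) f ≡ ∑[ x ∈ xs ] ∑ (g x) f
∑-concatMap g []       f = refl
∑-concatMap g (x ∷ xs) f =
  trans (∑-++ (g x) (concatMap g xs) f) (cong (∑ (g x) f +_) (∑-concatMap g xs f))

∑-map : ∀ {A B : Set} (h : A → B) xs (f : B → ℚ) → ∑ (map h xs) f ≡ ∑ xs (f ∘ h)
∑-map h []       f = refl
∑-map h (x ∷ xs) f = cong (f (h x) +_) (∑-map h xs f)

∑-cong : ∀ {A : Set} {f g : A → ℚ} xs → (∀ x → f x ≡ g x) → ∑ xs f ≡ ∑ xs g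
∑-cong []       f≡g = refl
∑-cong (x ∷ xs) f≡g = cong₂ _+_ (f≡g x) (∑-cong xs f≡g)

∑-mono : ∀ {A : Set} {f g : A → ℚ} xs → (∀ x → f x ≤ℚ g x) → ∑ xs f ≤ℚ ∑ xs g
∑-mono []       f≤g = QP.≤-refl
∑-mono (x ∷ xs) f≤g = QP.+-mono-≤ (f≤g x) (∑-mono xs f≤g)

∑-nonneg : ∀ {A : Set} {f : A → ℚ} xs → (∀ x → 0ℚ ≤ℚ f x) → 0ℚ ≤ℚ ∑ xs f
∑-nonneg []       0≤f = QP.≤-refl
∑-nonneg (x ∷ xs) 0≤f = +-nonneg (0≤f x) (∑-nonneg xs 0≤f)

∑-zero : ∀ {A : Set} (xs : List A) → ∑ xs (λ _ → 0ℚ) ≡ 0ℚ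
∑-zero []       = refl
∑-zero (x ∷ xs) = trans (cong (0ℚ +_) (∑-zero xs)) (QP.+-identityˡ 0ℚ)

∑-+ : ∀ {A : Set} xs (f g : A → ℚ) → ∑[ x ∈ xs ] (f x + g x) ≡ ∑ xs f + ∑ xs g
∑-+ []       f g = sym (QP.+-identityˡ 0ℚ)
∑-+ (x ∷ xs) f g = trans (cong ((f x + g x) +_) (∑-+ xs f g)) (+-interchange (f x) (g x) _ _)

∑-*ˡ : ∀ {A : Set} (a : ℚ) xs (f : A → ℚ) → ∑[ x ∈ xs ] (a * f x) ≡ a * ∑ xs f
∑-*ˡ a []       f = sym (QP.*-zeroʳ a)
∑-*ˡ a (x ∷ xs) f = trans (cong (a * f x +_) (∑-*ˡ a xs f)) (sym (QP.*-distribˡ-+ a _ _))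

∑-*ʳ : ∀ {A : Set} (a : ℚ) xs (f : A → ℚ) → ∑[ x ∈ xs ] (f x * a) ≡ ∑ xs f * a
∑-*ʳ a []       f = sym (QP.*-zeroˡ a)
∑-*ʳ a (x ∷ xs) f = trans (cong (f x * a +_) (∑-*ʳ a xs f)) (sym (QP.*-distribʳ-+ a (f x) (∑ xs f)))

∑-swap : ∀ {A B : Set} xs ys (g : A → B → ℚ) →
  ∑[ x ∈ xs ] ∑[ y ∈ ys ] g x y ≡ ∑[ y ∈ ys ] ∑[ x ∈ xs ] g x y
∑-swap []       ys g = sym (∑-zero ys)
∑-swap (x ∷ xs) ys g =
  trans (cong (∑ ys (g x) +_) (∑-swap xs ys g)) (sym (∑-+ ys (g x) (λ y → ∑[ x ∈ xs ] g x y)))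

𝟙 : Bool → ℚ → ℚ
𝟙 b v = if b then v else 0ℚ

∑-filter : ∀ {A : Set} {p} {P : Pred A p} (P? : Decidable P) xs (f : A → ℚ) →
  ∑ (filter P? xs) f ≡ ∑[ x ∈ xs ] 𝟙 (does (P? x)) (f x)
∑-filter P? []       f = refl
∑-filter P? (x ∷ xs) f with does (P? x)
... | true  = cong (f x +_) (∑-filter P? xs f)
... | false = trans (∑-filter P? xs f) (sym (QP.+-identityˡ _))

𝟙-nonneg : ∀ b {v} → 0ℚ ≤ℚ v → 0ℚ ≤ℚ 𝟙 b v
𝟙-nonneg true  0≤v = 0≤v
𝟙-nonneg false 0≤v = QP.≤-refl

𝟙-≤ : ∀ b {v} → 0ℚ ≤ℚ v → 𝟙 b v ≤ℚ v
𝟙-≤ true  0≤v = QP.≤-refl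
𝟙-≤ false 0≤v = 0≤v

𝟙-*ˡ : ∀ b a v → 𝟙 b (a * v) ≡ a * 𝟙 b v
𝟙-*ˡ true  a v = refl
𝟙-*ˡ false a v = sym (QP.*-zeroʳ a)

𝟙-∧ : ∀ b₁ b₂ u v → 𝟙 (b₁ ∧ b₂) (u * v) ≡ 𝟙 b₁ u * 𝟙 b₂ v
𝟙-∧ true  b₂ u v = 𝟙-*ˡ b₂ u v
𝟙-∧ false b₂ u v = sym (QP.*-zeroˡ (𝟙 b₂ v))

𝟙-∧-≤ : ∀ b₁ b₂ {v} → 0ℚ ≤ℚ v → 𝟙 (b₁ ∧ b₂) v ≤ℚ 𝟙 b₂ v
𝟙-∧-≤ true  b₂ 0≤v = QP.≤-refl
𝟙-∧-≤ false b₂ 0≤v = 𝟙-nonneg b₂ 0≤v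

𝟙-∨-≤ : ∀ b₁ b₂ {v} → 0ℚ ≤ℚ v → 𝟙 (b₁ ∨ b₂) v ≤ℚ 𝟙 b₁ v + 𝟙 b₂ v
𝟙-∨-≤ true  b₂ {v} 0≤v = ≤-+ʳ v (𝟙-nonneg b₂ 0≤v)
𝟙-∨-≤ false b₂ {v} 0≤v = QP.≤-reflexive (sym (QP.+-identityˡ (𝟙 b₂ v)))

T-does : ∀ {P : Set} (P? : Dec P) → T (does P?) → P
T-does (yes p) _ = p

𝟙-*-mono : ∀ b {a u v} → 0ℚ ≤ℚ a → (T b → u ≤ℚ v) → 𝟙 b a * u ≤ℚ 𝟙 b a * v
𝟙-*-mono true  {a} 0≤a u≤v = *-monoˡ-nonneg a 0≤a (u≤v tt)
𝟙-*-mono false {a} {u} {v} 0≤a u≤v = QP.≤-reflexive (trans (QP.*-zeroˡ u) (sym (QP.*-zeroˡ v)))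

∑-allFin-suc : ∀ {n} (f : Fin (suc n) → ℚ) →
  ∑ (allFin (suc n)) f ≡ f zero + ∑[ x ∈ allFin n ] f (suc x)
∑-allFin-suc {n} f = cong (f zero +_)
  (trans (cong sumℚ (LP.map-tabulate suc f)) (sym (cong sumℚ (LP.map-tabulate id (f ∘ suc)))))

∑-δ : ∀ n (a : Fin n) (f : Fin n → ℚ) → ∑[ y ∈ allFin n ] 𝟙 (does (y ≟ a)) (f y) ≡ f a
∑-δ (suc n) zero f =
  trans (∑-allFin-suc (λ y → 𝟙 (does (y ≟ zero)) (f y)))
        (trans (cong (f zero +_) (∑-zero (allFin n))) (QP.+-identityʳ _))
∑-δ (suc n) (suc a) f =
  trans (∑-allFin-suc (λ y → 𝟙 (does (y ≟ suc a)) (f y)))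
        (trans (cong (0ℚ +_) (∑-δ n a (f ∘ suc))) (QP.+-identityˡ _))

∑-supported : ∀ n (a : Fin n) (f : Fin n → ℚ) → (∀ x → ¬ x ≡ a → f x ≡ 0ℚ) → ∑ (allFin n) f ≡ f a
∑-supported n a f vanishes = trans (∑-cong (allFin n) restrict) (∑-δ n a f)
  where
  restrict : ∀ x → f x ≡ 𝟙 (does (x ≟ a)) (f x)
  restrict x with x ≟ a
  ... | yes _   = refl
  ... | no  x≢a = vanishes x x≢a

term-≤-∑ : ∀ n (f : Fin n → ℚ) a → (∀ y → 0ℚ ≤ℚ f y) → f a ≤ℚ ∑ (allFin n) f
term-≤-∑ n f a 0≤f = subst (_≤ℚ ∑ (allFin n) f) (∑-δ n a f)
  (∑-mono (allFin n) (λ y → 𝟙-≤ (does (y ≟ a)) (0≤f y)))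

∑-const : ∀ n (v : ℚ) → ∑[ _ ∈ allFin n ] v ≡ ℕ→ℚ n * v
∑-const zero    v = sym (QP.*-zeroˡ v)
∑-const (suc n) v = begin
  ∑[ _ ∈ allFin (suc n) ] v   ≡⟨ ∑-allFin-suc {n} (λ _ → v) ⟩
  v + ∑[ _ ∈ allFin n ] v     ≡⟨ cong (v +_) (∑-const n v) ⟩
  v + ℕ→ℚ n * v               ≡⟨ cong (_+ ℕ→ℚ n * v) (sym (QP.*-identityˡ v)) ⟩
  1ℚ * v + ℕ→ℚ n * v          ≡⟨ sym (QP.*-distribʳ-+ v 1ℚ (ℕ→ℚ n)) ⟩
  (1ℚ + ℕ→ℚ n) * v            ≡⟨ cong (_* v) (sym (ℕ→ℚ-suc n)) ⟩
  ℕ→ℚ (suc n) * v             ∎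
  where open ≡-Reasoning

edge : ∀ {n} → ℚ → Fin n → Fin n → ℚ
edge B x y = if does (x ≟ y) then B else 1ℚ

∑-edge : ∀ (B : ℚ) n (y : Fin n) → ∑[ x ∈ allFin n ] edge B x y ≡ B + ℕ→ℚ (n ∸ 1)
∑-edge B (suc n) zero =
  trans (∑-allFin-suc {n} (λ x → edge B x zero))
        (cong (B +_) (trans (∑-const n 1ℚ) (QP.*-identityʳ _)))
∑-edge B (suc (suc n)) (suc y) = begin
  ∑[ x ∈ allFin (suc (suc n)) ] edge B x (suc y)  ≡⟨ ∑-allFin-suc {suc n} (λ x → edge B x (suc y)) ⟩
  1ℚ + ∑[ x ∈ allFin (suc n) ] edge B x y         ≡⟨ cong (1ℚ +_) (∑-edge B (suc n) y) ⟩
  1ℚ + (B + ℕ→ℚ n)                               ≡⟨ sym (QP.+-assoc 1ℚ B (ℕ→ℚ n)) ⟩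
  (1ℚ + B) + ℕ→ℚ n                               ≡⟨ cong (_+ ℕ→ℚ n) (QP.+-comm 1ℚ B) ⟩
  (B + 1ℚ) + ℕ→ℚ n                               ≡⟨ QP.+-assoc B 1ℚ (ℕ→ℚ n) ⟩
  B + (1ℚ + ℕ→ℚ n)                               ≡⟨ cong (B +_) (sym (ℕ→ℚ-suc n)) ⟩
  B + ℕ→ℚ (suc n)                                ∎
  where open ≡-Reasoning

module PathPotts (q : ℕ) (B : ℚ) (0≤B : 0ℚ ≤ℚ B) (B≤1 : B ≤ℚ 1ℚ) where

  colours : List (Fin q)
  colours = allFin q

  colourings : (m : ℕ) → List (Colouring q m)
  colourings m = allColourings q m

  w : ∀ {m} → Colouring q m → ℚ
  w = weight B

  e : Fin q → Fin q → ℚ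
  e = edge B

  L D : ℚ
  L = B + ℕ→ℚ (q ∸ 1)
  D = 1ℚ + B

  D-nonneg : 0ℚ ≤ℚ D
  D-nonneg = +-nonneg (QP.nonNegative⁻¹ 1ℚ) 0≤B

  B≤e : ∀ x y → B ≤ℚ e x y
  B≤e x y with does (x ≟ y)
  ... | true  = QP.≤-refl
  ... | false = B≤1

  e≤1 : ∀ x y → e x y ≤ℚ 1ℚ
  e≤1 x y with does (x ≟ y)
  ... | true  = B≤1
  ... | false = QP.≤-refl

  e-nonneg : ∀ x y → 0ℚ ≤ℚ e x y
  e-nonneg x y = QP.≤-trans 0≤B (B≤e x y)

  e-diagonal : ∀ x → e x x ≡ B
  e-diagonal x with x ≟ x
  ... | yes _   = refl
  ... | no  x≢x = ⊥-elim (x≢x refl)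

  w-nonneg : ∀ {m} (σ : Colouring q m) → 0ℚ ≤ℚ w σ
  w-nonneg σ = ^-nonneg (mono σ) 0≤B

  w-cons : ∀ {m} x y (τ : Colouring q m) → w (x ∷ y ∷ τ) ≡ e x y * w (y ∷ τ)
  w-cons x y τ with does (x ≟ y)
  ... | true  = refl
  ... | false = sym (QP.*-identityˡ _)

  ∑-colourings-suc : ∀ m (f : Colouring q (suc m) → ℚ) →
    ∑ (colourings (suc m)) f ≡ ∑[ x ∈ colours ] ∑[ τ ∈ colourings m ] f (x ∷ τ)
  ∑-colourings-suc m f = trans (∑-concatMap (λ x → map (x ∷_) (colourings m)) colours f)
                               (∑-cong colours (λ x → ∑-map (x ∷_) (colourings m) f))

  endsIn : ∀ {m} → Fin q → Colouring q (suc m) → ℚ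
  endsIn c' τ = 𝟙 (does (last τ ≟ c')) (w τ)

  Zlast : ℕ → Fin q → ℚ
  Zlast m c' = ∑ (colourings (suc m)) (endsIn c')

  endsIn-cons : ∀ {m} x (τ : Colouring q (suc m)) c' → endsIn c' (x ∷ τ) ≡ e x (head τ) * endsIn c' τ
  endsIn-cons x (y ∷ τ) c' =
    trans (cong (𝟙 (does (last (y ∷ τ) ≟ c'))) (w-cons x y τ))
          (𝟙-*ˡ (does (last (y ∷ τ) ≟ c')) (e x y) (w (y ∷ τ)))

  Zlast-suc : ∀ m c' → Zlast (suc m) c' ≡ L * Zlast m c'
  Zlast-suc m c' = begin
    Zlast (suc m) c'
      ≡⟨ ∑-colourings-suc (suc m) (endsIn c') ⟩
    ∑[ x ∈ colours ] ∑[ τ ∈ τs ] endsIn c' (x ∷ τ)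
      ≡⟨ ∑-cong colours (λ x → ∑-cong τs (λ τ → endsIn-cons x τ c')) ⟩
    ∑[ x ∈ colours ] ∑[ τ ∈ τs ] (e x (head τ) * endsIn c' τ)
      ≡⟨ ∑-swap colours τs (λ x τ → e x (head τ) * endsIn c' τ) ⟩
    ∑[ τ ∈ τs ] ∑[ x ∈ colours ] (e x (head τ) * endsIn c' τ)
      ≡⟨ ∑-cong τs (λ τ → ∑-*ʳ (endsIn c' τ) colours (λ x → e x (head τ))) ⟩
    ∑[ τ ∈ τs ] (∑[ x ∈ colours ] e x (head τ) * endsIn c' τ)
      ≡⟨ ∑-cong τs (λ τ → cong (_* endsIn c' τ) (∑-edge B q (head τ))) ⟩
    ∑[ τ ∈ τs ] (L * endsIn c' τ)
      ≡⟨ ∑-*ˡ L τs (endsIn c') ⟩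
    L * Zlast m c' ∎
    where
    open ≡-Reasoning
    τs : List (Colouring q (suc m))
    τs = colourings (suc m)

  Zlast-exact : ∀ m c' → Zlast m c' ≡ L ^ℚ m
  Zlast-exact zero c' = begin
    Zlast zero c'                                      ≡⟨ ∑-colourings-suc zero (endsIn c') ⟩
    ∑[ x ∈ colours ] (𝟙 (does (x ≟ c')) 1ℚ + 0ℚ)       ≡⟨ ∑-cong colours (λ x → QP.+-identityʳ _) ⟩
    ∑[ x ∈ colours ] 𝟙 (does (x ≟ c')) 1ℚ              ≡⟨ ∑-δ q c' (λ _ → 1ℚ) ⟩
    1ℚ                                                 ∎
    where open ≡-Reasoning
  Zlast-exact (suc m) c' = trans (Zlast-suc m c') (cong (L *_) (Zlast-exact m c'))

  -- Prescribing the first colour as well costs at most one edge factor B.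
  Zend-lower : ∀ k (c c' : Fin q) → B * L ^ℚ k ≤ℚ Zend q (suc (suc k)) B c c'
  Zend-lower k c c' = begin
    B * L ^ℚ k                           ≡⟨ cong (B *_) (sym (Zlast-exact k c')) ⟩
    B * Zlast k c'                       ≡⟨ sym (∑-*ˡ B τs (endsIn c')) ⟩
    ∑[ τ ∈ τs ] (B * endsIn c' τ)        ≤⟨ ∑-mono τs first-edge ⟩
    ∑[ τ ∈ τs ] ends (c ∷ τ)             ≤⟨ term-≤-∑ q (λ x → ∑[ τ ∈ τs ] ends (x ∷ τ)) c
                                              (λ x → ∑-nonneg τs (λ τ → 𝟙-nonneg _ (w-nonneg (x ∷ τ)))) ⟩
    ∑[ x ∈ colours ] ∑[ τ ∈ τs ] ends (x ∷ τ)   ≡⟨ sym (∑-colourings-suc (suc k) ends) ⟩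
    ∑ (colourings (suc (suc k))) ends    ≡⟨ sym (∑-filter (endCond? c c') (colourings (suc (suc k))) w) ⟩
    Zend q (suc (suc k)) B c c'          ∎
    where
    open QP.≤-Reasoning
    τs : List (Colouring q (suc k))
    τs = colourings (suc k)

    ends : Colouring q (suc (suc k)) → ℚ
    ends σ = 𝟙 (does (endCond? c c' σ)) (w σ)

    first-edge : ∀ τ → B * endsIn c' τ ≤ℚ ends (c ∷ τ)
    first-edge (y ∷ τ) with c ≟ c | does (last (y ∷ τ) ≟ c')
    ... | no c≢c | _     = ⊥-elim (c≢c refl)
    ... | yes _  | false = QP.≤-reflexive (QP.*-zeroʳ B)
    ... | yes _  | true  = subst (B * w (y ∷ τ) ≤ℚ_) (sym (w-cons c y τ))
                                 (*-monoʳ-nonneg (w (y ∷ τ)) (w-nonneg (y ∷ τ)) (B≤e c y))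

  module TwoColours (a b : Fin q) where

    inAB? : Decidable (λ y → y ≡ a ⊎ y ≡ b)
    inAB? y = (y ≟ a) ⊎-dec (y ≟ b)

    onlyAB : ∀ {m} → Colouring q m → Bool
    onlyAB τ = does (all? inAB? τ)

    restricted : ∀ {m} → Fin q → Colouring q m → ℚ
    restricted x τ = 𝟙 (onlyAB τ) (w (x ∷ τ))

    restricted-nonneg : ∀ {m} x (τ : Colouring q m) → 0ℚ ≤ℚ restricted x τ
    restricted-nonneg x τ = 𝟙-nonneg (onlyAB τ) (w-nonneg (x ∷ τ))

    restricted-cons : ∀ {m} x y (τ : Colouring q m) →
      restricted x (y ∷ τ) ≡ 𝟙 (does (inAB? y)) (e x y) * restricted y τ
    restricted-cons x y τ = trans (cong (𝟙 (onlyAB (y ∷ τ))) (w-cons x y τ))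
                                  (𝟙-∧ (does (inAB? y)) (onlyAB τ) (e x y) (w (y ∷ τ)))

    edge-pair-≤ : ∀ x → x ≡ a ⊎ x ≡ b → e x a + e x b ≤ℚ D
    edge-pair-≤ x (inj₁ refl) = begin
      e x x + e x b   ≡⟨ cong (_+ e x b) (e-diagonal x) ⟩
      B + e x b       ≤⟨ QP.+-monoʳ-≤ B (e≤1 x b) ⟩
      B + 1ℚ          ≡⟨ QP.+-comm B 1ℚ ⟩
      D               ∎
      where open QP.≤-Reasoning
    edge-pair-≤ x (inj₂ refl) = begin
      e x a + e x x   ≡⟨ cong (e x a +_) (e-diagonal x) ⟩
      e x a + B       ≤⟨ QP.+-monoˡ-≤ B (e≤1 x a) ⟩
      D               ∎
      where open QP.≤-Reasoning

    next-vertex-≤ : ∀ x → x ≡ a ⊎ x ≡ b → ∑[ y ∈ colours ] 𝟙 (does (inAB? y)) (e x y) ≤ℚ D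
    next-vertex-≤ x x∈ab = begin
      ∑[ y ∈ colours ] 𝟙 (does (inAB? y)) (e x y)
        ≤⟨ ∑-mono colours (λ y → 𝟙-∨-≤ (does (y ≟ a)) (does (y ≟ b)) (e-nonneg x y)) ⟩
      ∑[ y ∈ colours ] (𝟙 (does (y ≟ a)) (e x y) + 𝟙 (does (y ≟ b)) (e x y))
        ≡⟨ ∑-+ colours (λ y → 𝟙 (does (y ≟ a)) (e x y)) (λ y → 𝟙 (does (y ≟ b)) (e x y)) ⟩
      ∑[ y ∈ colours ] 𝟙 (does (y ≟ a)) (e x y) + ∑[ y ∈ colours ] 𝟙 (does (y ≟ b)) (e x y)
        ≡⟨ cong₂ _+_ (∑-δ q a (e x)) (∑-δ q b (e x)) ⟩
      e x a + e x b
        ≤⟨ edge-pair-≤ x x∈ab ⟩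
      D ∎
      where open QP.≤-Reasoning

    restricted-≤ : ∀ m x → x ≡ a ⊎ x ≡ b → ∑ (colourings m) (restricted x) ≤ℚ D ^ℚ m
    restricted-≤ zero    x x∈ab = QP.≤-reflexive (QP.+-identityʳ 1ℚ)
    restricted-≤ (suc m) x x∈ab = begin
      ∑ (colourings (suc m)) (restricted x)
        ≡⟨ ∑-colourings-suc m (restricted x) ⟩
      ∑[ y ∈ colours ] ∑[ τ ∈ colourings m ] restricted x (y ∷ τ)
        ≡⟨ ∑-cong colours (λ y → trans (∑-cong (colourings m) (restricted-cons x y))
                                       (∑-*ˡ (step y) (colourings m) (restricted y))) ⟩
      ∑[ y ∈ colours ] (step y * ∑ (colourings m) (restricted y))
        ≤⟨ ∑-mono colours (λ y → 𝟙-*-mono (does (inAB? y)) (e-nonneg x y)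
                                   (λ y∈ab → restricted-≤ m y (T-does (inAB? y) y∈ab))) ⟩
      ∑[ y ∈ colours ] (step y * D ^ℚ m)
        ≡⟨ ∑-*ʳ (D ^ℚ m) colours step ⟩
      ∑ colours step * D ^ℚ m
        ≤⟨ *-monoʳ-nonneg (D ^ℚ m) (^-nonneg m D-nonneg) (next-vertex-≤ x x∈ab) ⟩
      D * D ^ℚ m ∎
      where
      open QP.≤-Reasoning
      step : Fin q → ℚ
      step y = 𝟙 (does (inAB? y)) (e x y)

  open TwoColours using (restricted; restricted-nonneg; restricted-≤)

  two-coloured-≤ : ∀ {m} c b (τ : Colouring q m) → All (λ y → y ≡ c ⊎ y ≡ b) τ →
    w (c ∷ τ) ≤ℚ ∑[ b ∈ colours ] restricted c b c τ
  two-coloured-≤ c b τ τ∈cb =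
    subst (λ t → 𝟙 t (w (c ∷ τ)) ≤ℚ _) (dec-true (all? (TwoColours.inAB? c b) τ) τ∈cb)
          (term-≤-∑ q (λ b → restricted c b c τ) b (λ b → restricted-nonneg c b c τ))

  bichromatic-≤ : ∀ {m} c (τ : Colouring q m) →
    𝟙 (does (bichromatic? (c ∷ τ))) (w (c ∷ τ)) ≤ℚ ∑[ b ∈ colours ] restricted c b c τ
  bichromatic-≤ c τ with bichromatic? (c ∷ τ)
  ... | no _                            = ∑-nonneg colours (λ b → restricted-nonneg c b c τ)
  ... | yes (_ , b , inj₁ refl ∷ τ∈cb) = two-coloured-≤ c b τ τ∈cb
  ... | yes (b , _ , inj₂ refl ∷ τ∈bc) = two-coloured-≤ c b τ (All-map swap τ∈bc)

  ZendBich-upper : ∀ k (c c' : Fin q) → ZendBich q (suc (suc k)) B c c' ≤ℚ ℕ→ℚ q * D ^ℚ suc k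
  ZendBich-upper k c c' = begin
    ZendBich q (suc (suc k)) B c c'
      ≡⟨ ∑-filter (λ σ → endCond? c c' σ ×-dec bichromatic? σ) (colourings (suc (suc k))) w ⟩
    ∑ (colourings (suc (suc k))) counted
      ≡⟨ ∑-colourings-suc (suc k) counted ⟩
    ∑[ x ∈ colours ] ∑[ τ ∈ τs ] counted (x ∷ τ)
      ≡⟨ ∑-supported q c (λ x → ∑[ τ ∈ τs ] counted (x ∷ τ))
           (λ x x≢c → trans (∑-cong τs (λ τ → not-starting-at-c x x≢c τ)) (∑-zero τs)) ⟩
    ∑[ τ ∈ τs ] counted (c ∷ τ)
      ≤⟨ ∑-mono τs (λ τ → QP.≤-trans (𝟙-∧-≤ (does (endCond? c c' (c ∷ τ))) _ (w-nonneg (c ∷ τ)))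
                                    (bichromatic-≤ c τ)) ⟩
    ∑[ τ ∈ τs ] ∑[ b ∈ colours ] restricted c b c τ
      ≡⟨ sym (∑-swap colours τs (λ b τ → restricted c b c τ)) ⟩
    ∑[ b ∈ colours ] ∑ τs (restricted c b c)
      ≤⟨ ∑-mono colours (λ b → restricted-≤ c b (suc k) c (inj₁ refl)) ⟩
    ∑[ _ ∈ colours ] (D ^ℚ suc k)
      ≡⟨ ∑-const q (D ^ℚ suc k) ⟩
    ℕ→ℚ q * D ^ℚ suc k ∎
    where
    open QP.≤-Reasoning
    τs : List (Colouring q (suc k))
    τs = colourings (suc k)

    counted : Colouring q (suc (suc k)) → ℚ
    counted σ = 𝟙 (does (endCond? c c' σ ×-dec bichromatic? σ)) (w σ)

    not-starting-at-c : ∀ x → ¬ x ≡ c → ∀ τ → counted (x ∷ τ) ≡ 0ℚ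
    not-starting-at-c x x≢c τ with x ≟ c
    ... | yes x≡c = ⊥-elim (x≢c x≡c)
    ... | no  _   = refl

÷-nonneg : ∀ {p r} → 0ℚ ≤ℚ p → (0<r : 0ℚ < r) → 0ℚ ≤ℚ (p ÷ r) {{QP.pos⇒nonZero r {{positive 0<r}}}}
÷-nonneg {p} {r} 0≤p 0<r = *-nonneg 0≤p (QP.nonNegative⁻¹ (1/ r) {{QP.pos⇒nonNeg (1/ r) {{QP.1/pos⇒pos r}}}})
  where instance
    r>0 : Positive r
    r>0 = positive 0<r
    r≢0 : NonZero r
    r≢0 = QP.pos⇒nonZero r

prefactor-identity : ∀ q B (0<B : 0ℚ < B) k →
  (fourqOverB q B 0<B * χ q B 0<B ^ℚ k) * (B * (B + ℕ→ℚ (q ∸ 1)) ^ℚ k) ≡ ℕ→ℚ (4 ℕ.* q) * (1ℚ + B) ^ℚ k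
prefactor-identity q B 0<B k = begin
  (F * 1/ B * (D * 1/ L) ^ℚ k) * (B * L ^ℚ k)   ≡⟨ *-interchange (F * 1/ B) ((D * 1/ L) ^ℚ k) B (L ^ℚ k) ⟩
  (F * 1/ B * B) * ((D * 1/ L) ^ℚ k * L ^ℚ k)   ≡⟨ cong₂ _*_ (cancel F B) (sym (^-distrib-* (D * 1/ L) L k)) ⟩
  F * (D * 1/ L * L) ^ℚ k                       ≡⟨ cong (λ t → F * t ^ℚ k) (cancel D L) ⟩
  F * D ^ℚ k                                    ∎
  where
  open ≡-Reasoning
  F D L : ℚ
  F = ℕ→ℚ (4 ℕ.* q)
  D = 1ℚ + B
  L = B + ℕ→ℚ (q ∸ 1)
  instance
    B≢0 : NonZero B
    B≢0 = QP.pos⇒nonZero B {{positive 0<B}}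
    L≢0 : NonZero L
    L≢0 = QP.pos⇒nonZero L {{positive (denom-pos q B 0<B)}}

  cancel : ∀ x y .{{_ : NonZero y}} → x * 1/ y * y ≡ x
  cancel x y = trans (QP.*-assoc x (1/ y) y) (trans (cong (x *_) (QP.*-inverseˡ y)) (QP.*-identityʳ x))

q*D≤4q : ∀ q B → B ≤ℚ 1ℚ → ℕ→ℚ q * (1ℚ + B) ≤ℚ ℕ→ℚ (4 ℕ.* q)
q*D≤4q q B B≤1 = begin
  Q * (1ℚ + B)                     ≡⟨ QP.*-distribˡ-+ Q 1ℚ B ⟩
  Q * 1ℚ + Q * B                   ≤⟨ QP.+-monoʳ-≤ (Q * 1ℚ) (*-monoˡ-nonneg Q (ℕ→ℚ-nonneg q) B≤1) ⟩
  Q * 1ℚ + Q * 1ℚ                  ≡⟨ cong₂ _+_ (QP.*-identityʳ Q) (QP.*-identityʳ Q) ⟩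
  Q + Q                            ≤⟨ QP.+-monoʳ-≤ Q (≤-+ʳ Q (ℕ→ℚ-nonneg (q ℕ.+ (q ℕ.+ 0)))) ⟩
  Q + (Q + ℕ→ℚ (q ℕ.+ (q ℕ.+ 0)))  ≡⟨ sym (trans (ℕ→ℚ-+ q _) (cong (Q +_) (ℕ→ℚ-+ q _))) ⟩
  ℕ→ℚ (4 ℕ.* q)                    ∎
  where
  open QP.≤-Reasoning
  Q : ℚ
  Q = ℕ→ℚ q

lemma8p2 : (q : ℕ) → 3 ≤ q → (B : ℚ) → (0<B : 0ℚ < B) → B < 1ℚ →
    (ℓ : ℕ) → 2 ≤ ℓ → (c c' : Fin q) →
    ZendBich q ℓ B c c' ≤ℚ (fourqOverB q B 0<B * (χ q B 0<B ^ℚ (ℓ ∸ 2))) * Zend q ℓ B c c'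
lemma8p2 q _ B 0<B B<1 (suc (suc k)) (s≤s (s≤s _)) c c' = begin
  ZendBich q (suc (suc k)) B c c'     ≤⟨ ZendBich-upper k c c' ⟩
  ℕ→ℚ q * (D * D ^ℚ k)                ≡⟨ sym (QP.*-assoc (ℕ→ℚ q) D (D ^ℚ k)) ⟩
  (ℕ→ℚ q * D) * D ^ℚ k                ≤⟨ *-monoʳ-nonneg (D ^ℚ k) (^-nonneg k D-nonneg) (q*D≤4q q B B≤1) ⟩
  ℕ→ℚ (4 ℕ.* q) * D ^ℚ k              ≡⟨ sym (prefactor-identity q B 0<B k) ⟩
  coefficient * (B * L ^ℚ k)          ≤⟨ *-monoˡ-nonneg coefficient coefficient-nonneg (Zend-lower k c c') ⟩
  coefficient * Zend q (suc (suc k)) B c c' ∎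
  where
  B≤1 : B ≤ℚ 1ℚ
  B≤1 = QP.<⇒≤ B<1
  open PathPotts q B (QP.<⇒≤ 0<B) B≤1
  open QP.≤-Reasoning

  coefficient : ℚ
  coefficient = fourqOverB q B 0<B * χ q B 0<B ^ℚ k

  coefficient-nonneg : 0ℚ ≤ℚ coefficient
  coefficient-nonneg = *-nonneg (÷-nonneg (ℕ→ℚ-nonneg (4 ℕ.* q)) 0<B)
                                (^-nonneg k (÷-nonneg D-nonneg (denom-pos q B 0<B)))
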